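{- Let $(X,\odot,\ell,r)$ be an $\ell r$-multimagma in which there exist $x,y,z,w\in X$ (not necessarily distinct) such that $\ell(x)\odot\ell(y)\neq\emptyset$ and $z\odot w\neq\emptyset$. Let $(Q,\le,\cdot,1)$ be a prequantale with maps $\textit{dom},\textit{cod}:Q\to Q$, and suppose that $(Q^X,\le,\ast,\textit{id}_E,\textit{Dom},\textit{Cod})$ is a modal prequantale with $\textit{id}_E\neq\bot$. \begin{enumerate} \item Then $(Q,\le,\cdot,1,\textit{dom},\textit{cod})$ is a modal prequantale. \item If moreover $X$ is an $\ell r$-multisemigroup and $(Q^X,\le,\ast,\textit{id}_E,\textit{Dom},\textit{Cod})$ is a weakly local modal quantale, then $Q$ is a weakly local modal quantale. \item If moreover $X$ is a local $\ell r$-multisemigroup and $(Q^X,\le,\ast,\textit{id}_E,\textit{Dom},\textit{Cod})$ is a modal quantale, then $Q$ is a modal quantale. \end{enumerate}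
   Context: A multimagma is a non-empty set $X$ with $\odot:X\times X\to\mathcal{P}X$; for $A,B\subseteq X$, $A\odot B=\bigcup\{a\odot b\mid a\in A,b\in B\}$; $D_{xy}$ means $x\odot y\neq\emptyset$. An $\ell r$-multimagma is a multimagma with maps $\ell,r:X\to X$ such that $D_{xy}\Rightarrow r(x)=\ell(y)$, $\ell(x)\odot x=\{x\}$, $x\odot r(x)=\{x\}$ for all $x,y$. An $\ell r$-multisemigroup is an $\ell r$-multimagma with $x\odot(y\odot z)=(x\odot y)\odot z$ for all $x,y,z$; it is local if $r(x)=\ell(y)\Rightarrow D_{xy}$. $E=\{x\in X\mid\ell(x)=x\}$. A prequantale $(Q,\le,\cdot,1)$ is a complete lattice with a binary operation $\cdot$ with two-sided unit $1$ preserving arbitrary sups in each argument; $\bot$ least element. A modal prequantale: prequantale with $\textit{dom},\textit{cod}$ such that $\alpha\le\textit{dom}(\alpha)\cdot\alpha$, $\textit{dom}(\textit{dom}(\alpha)\cdot\beta)=\textit{dom}(\alpha)\cdot\textit{dom}(\beta)$, $\textit{dom}(\alpha)\le1$, $\textit{dom}(\bot)=\bot$, $\textit{dom}(\alpha\vee\beta)=\textit{dom}(\alpha)\vee\textit{dom}(\beta)$, the opposite axioms for $\textit{cod}$ (with arguments of $\cdot$ swapped, e.g. $\textit{cod}(\alpha\cdot\textit{cod}(\beta))=\textit{cod}(\alpha)\cdot\textit{cod}(\beta)$), and $\textit{dom}\circ\textit{cod}=\textit{cod}$, $\textit{cod}\circ\textit{dom}=\textit{dom}$. A weakly local modal quantale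 is a modal prequantale with associative $\cdot$. A modal quantale is a prequantale with associative $\cdot$ and $\textit{dom},\textit{cod}$ satisfying the same axioms but with the export axioms replaced by locality: $\textit{dom}(\alpha\cdot\textit{dom}(\beta))=\textit{dom}(\alpha\cdot\beta)$, $\textit{cod}(\textit{cod}(\alpha)\cdot\beta)=\textit{cod}(\alpha\cdot\beta)$. On $Q^X$: pointwise order; $(f\ast g)(x)=\bigvee\{f(y)\cdot g(z)\mid x\in y\odot z\}$; $\textit{id}_E(x)=1$ if $x\in E$, else $\bot$; $\textit{Dom}(f)(y)=\bigvee\{\textit{dom}(f(x))\mid\ell(x)=y\}$; $\textit{Cod}(f)(y)=\bigvee\{\textit{cod}(f(x))\mid r(x)=y\}$. -}

module Defs where

open import Level using (0ℓ)
open import Data.Bool using (Bool; true; false; if_then_else_)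
open import Data.Empty using (⊥) renaming (⊥-elim to ⊥-elim)
open import Data.Product using (Σ; ∃; _×_; _,_; proj₁; proj₂)
open import Relation.Binary.Core using (Rel)
open import Relation.Binary.Structures using (IsPartialOrder)
open import Relation.Binary.PropositionalEquality using (_≡_)
open import Function.Bundles using (_⇔_)

-- Multimagmas.  A multioperation X × X → 𝒫X is a predicate-valued map:
-- (x ⊙ y) w  means  w ∈ x ⊙ y.

MultiOp : Set → Set₁
MultiOp X = X → X → X → Set

D : {X : Set} → MultiOp X → X → X → Set
D {X} _⊙_ x y = ∃ λ w → (x ⊙ y) w

IsSingleton : {X : Set} → (X → Set) → X → Set
IsSingleton {X} A x = ∀ w → (A w ⇔ (w ≡ x))

record IsLRMultimagma (X : Set) (_⊙_ : MultiOp X) (ℓ r : X → X) : Set where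
  field
    D⇒match : ∀ x y → D _⊙_ x y → r x ≡ ℓ y
    ℓ-unit  : ∀ x → IsSingleton ((ℓ x) ⊙ x) x
    r-unit  : ∀ x → IsSingleton (x ⊙ (r x)) x

-- x ⊙ (y ⊙ z) = (x ⊙ y) ⊙ z, with A ⊙ B = ⋃ { a ⊙ b | a ∈ A, b ∈ B }
record IsLRMultisemigroup (X : Set) (_⊙_ : MultiOp X) (ℓ r : X → X) : Set where
  field
    isLRMultimagma : IsLRMultimagma X _⊙_ ℓ r
    assoc : ∀ x y z w →
      (∃ λ u → (y ⊙ z) u × (x ⊙ u) w) ⇔ (∃ λ u → (x ⊙ y) u × (u ⊙ z) w)

record IsLocalLRMultisemigroup (X : Set) (_⊙_ : MultiOp X) (ℓ r : X → X) : Set where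
  field
    isLRMultisemigroup : IsLRMultisemigroup X _⊙_ ℓ r
    local : ∀ x y → r x ≡ ℓ y → D _⊙_ x y

SupOp : Set → Set₁
SupOp A = {I : Set} → (I → A) → A

module _ {A : Set} (⋁ : SupOp A) where
  bot : A
  bot = ⋁ {⊥} ⊥-elim

  join : A → A → A
  join a b = ⋁ {Bool} (λ t → if t then a else b)

record IsPrequantale {A : Set} (_≈_ _≤_ : Rel A 0ℓ) (⋁ : SupOp A)
                     (_·_ : A → A → A) (e : A) : Set₁ where
  field
    isPartialOrder : IsPartialOrder _≈_ _≤_
    ⋁-upper : ∀ {I : Set} (f : I → A) (i : I) → f i ≤ ⋁ f
    ⋁-least : ∀ {I : Set} (f : I → A) (a : A) → (∀ i → f i ≤ a) → ⋁ f ≤ a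
    ·-⋁ˡ : ∀ (a : A) {I : Set} (f : I → A) → (a · ⋁ f) ≈ ⋁ (λ i → a · f i)
    ·-⋁ʳ : ∀ {I : Set} (f : I → A) (a : A) → (⋁ f · a) ≈ ⋁ (λ i → f i · a)
    identityˡ : ∀ a → (e · a) ≈ a
    identityʳ : ∀ a → (a · e) ≈ a

-- Axioms on dom/cod shared by modal prequantales and modal quantales
-- (everything except the export / locality axioms).
record ModalBase {A : Set} (_≈_ _≤_ : Rel A 0ℓ) (⋁ : SupOp A)
                 (_·_ : A → A → A) (e : A) (dom cod : A → A) : Set where
  field
    dom-cong   : ∀ {a b} → a ≈ b → dom a ≈ dom b
    cod-cong   : ∀ {a b} → a ≈ b → cod a ≈ cod b
    dom-absorb : ∀ a → a ≤ (dom a · a)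
    cod-absorb : ∀ a → a ≤ (a · cod a)
    dom-sub    : ∀ a → dom a ≤ e
    cod-sub    : ∀ a → cod a ≤ e
    dom-strict : dom (bot ⋁) ≈ bot ⋁
    cod-strict : cod (bot ⋁) ≈ bot ⋁
    dom-join   : ∀ a b → dom (join ⋁ a b) ≈ join ⋁ (dom a) (dom b)
    cod-join   : ∀ a b → cod (join ⋁ a b) ≈ join ⋁ (cod a) (cod b)
    dom-cod    : ∀ a → dom (cod a) ≈ cod a
    cod-dom    : ∀ a → cod (dom a) ≈ dom a

record IsModalPrequantale {A : Set} (_≈_ _≤_ : Rel A 0ℓ) (⋁ : SupOp A)
                          (_·_ : A → A → A) (e : A) (dom cod : A → A) : Set₁ where
  field
    isPrequantale : IsPrequantale _≈_ _≤_ ⋁ _·_ e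
    modalBase     : ModalBase _≈_ _≤_ ⋁ _·_ e dom cod
    dom-export    : ∀ a b → dom (dom a · b) ≈ (dom a · dom b)
    cod-export    : ∀ a b → cod (a · cod b) ≈ (cod a · cod b)

record IsWeaklyLocalModalQuantale {A : Set} (_≈_ _≤_ : Rel A 0ℓ) (⋁ : SupOp A)
                                  (_·_ : A → A → A) (e : A) (dom cod : A → A) : Set₁ where
  field
    isModalPrequantale : IsModalPrequantale _≈_ _≤_ ⋁ _·_ e dom cod
    ·-assoc : ∀ a b c → ((a · b) · c) ≈ (a · (b · c))

record IsModalQuantale {A : Set} (_≈_ _≤_ : Rel A 0ℓ) (⋁ : SupOp A)
                       (_·_ : A → A → A) (e : A) (dom cod : A → A) : Set₁ where
  field
    isPrequantale : IsPrequantale _≈_ _≤_ ⋁ _·_ e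
    ·-assoc       : ∀ a b c → ((a · b) · c) ≈ (a · (b · c))
    modalBase     : ModalBase _≈_ _≤_ ⋁ _·_ e dom cod
    dom-local     : ∀ a b → dom (a · dom b) ≈ dom (a · b)
    cod-local     : ∀ a b → cod (cod a · b) ≈ cod (a · b)

module FunSpace {X : Set} (_⊙_ : MultiOp X) (ℓ r : X → X)
                {Q : Set} (_≤_ : Rel Q 0ℓ) (⋁ : SupOp Q)
                (_·_ : Q → Q → Q) (e : Q) (dom cod : Q → Q) where

  _≈ᴾ_ : Rel (X → Q) 0ℓ
  f ≈ᴾ g = ∀ x → f x ≡ g x

  _≤ᴾ_ : Rel (X → Q) 0ℓ
  f ≤ᴾ g = ∀ x → f x ≤ g x

  ⋁ᴾ : SupOp (X → Q)
  ⋁ᴾ F x = ⋁ (λ i → F i x)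

  _∗_ : (X → Q) → (X → Q) → (X → Q)
  (f ∗ g) x = ⋁ {Σ (X × X) (λ p → (proj₁ p ⊙ proj₂ p) x)}
                (λ q → f (proj₁ (proj₁ q)) · g (proj₂ (proj₁ q)))

  -- id_E(x) = 1 if ℓ(x) = x, else ⊥  (written as ⋁ { 1 | ℓ(x) = x })
  idE : X → Q
  idE x = ⋁ {ℓ x ≡ x} (λ _ → e)

  Dom : (X → Q) → (X → Q)
  Dom f y = ⋁ {Σ X (λ x → ℓ x ≡ y)} (λ q → dom (f (proj₁ q)))

  Cod : (X → Q) → (X → Q)
  Cod f y = ⋁ {Σ X (λ x → r x ≡ y)} (λ q → cod (f (proj₁ q)))

-- Evaluation at a point a ∈ X with ℓ a = a = r a and a ∈ a ⊙ a (any a = ℓ x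
-- will do) is not a homomorphism Q^X → Q, but it is one on the functions that
-- attain their maximum at a: these contain the constants and are closed under
-- ∗, ⋁, id_E, Dom and Cod, and on them the value at a commutes with each of
-- these operations.  Each axiom of Q is thus the value at a of the same axiom
-- of Q^X instantiated at constant functions.
module Submission where

open import Defs
open import Level using (0ℓ)
open import Data.Bool using (true; false; if_then_else_)
open import Data.Product using (Σ; ∃; _×_; _,_; proj₁; proj₂)
open import Function.Base using (const)
open import Function.Bundles using (Equivalence)
open import Relation.Binary.Core using (Rel)
open import Relation.Binary.Structures using (IsPartialOrder)
open import Relation.Binary.PropositionalEquality
  using (_≡_; refl; sym; trans; cong; cong₂; subst)
open import Relation.Nullary using (¬_)

module PrequantaleProperties
  {Q : Set} {_≤_ : Rel Q 0ℓ} {⋁ : SupOp Q} {_·_ : Q → Q → Q} {e : Q}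
  (isPrequantale : IsPrequantale _≡_ _≤_ ⋁ _·_ e) where

  open IsPrequantale isPrequantale
  open IsPartialOrder isPartialOrder public
    using (antisym) renaming (refl to ≤-refl; trans to ≤-trans; reflexive to ≤-reflexive)

  ⋁-mono : ∀ {I : Set} {f g : I → Q} → (∀ i → f i ≤ g i) → ⋁ f ≤ ⋁ g
  ⋁-mono {f = f} {g} f≤g = ⋁-least f (⋁ g) (λ i → ≤-trans (f≤g i) (⋁-upper g i))

  ⋁-cong : ∀ {I : Set} {f g : I → Q} → (∀ i → f i ≡ g i) → ⋁ f ≡ ⋁ g
  ⋁-cong f≡g = antisym (⋁-mono (λ i → ≤-reflexive (f≡g i)))
                       (⋁-mono (λ i → ≤-reflexive (sym (f≡g i))))

  ⋁-attained : ∀ {I : Set} (f : I → Q) {v : Q} (i : I) →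
               f i ≡ v → (∀ j → f j ≤ v) → ⋁ f ≡ v
  ⋁-attained f i fi≡v f≤v =
    antisym (⋁-least f _ f≤v) (≤-trans (≤-reflexive (sym fi≡v)) (⋁-upper f i))

  join-upperˡ : ∀ α β → α ≤ join ⋁ α β
  join-upperˡ α β = ⋁-upper (λ t → if t then α else β) true

  join-absorbˡ : ∀ {α β} → α ≤ β → join ⋁ α β ≡ β
  join-absorbˡ α≤β = ⋁-attained _ false refl λ { true → α≤β ; false → ≤-refl }

  join-preserving⇒monotone : (d : Q → Q) →
    (∀ α β → d (join ⋁ α β) ≡ join ⋁ (d α) (d β)) →
    ∀ {α β} → α ≤ β → d α ≤ d β
  join-preserving⇒monotone d d-join {α} {β} α≤β =
    ≤-trans (join-upperˡ (d α) (d β))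
            (≤-reflexive (trans (sym (d-join α β)) (cong d (join-absorbˡ α≤β))))

  ·-joinʳ : ∀ α β γ → (join ⋁ α β · γ) ≡ join ⋁ (α · γ) (β · γ)
  ·-joinʳ α β γ = trans (·-⋁ʳ _ γ) (⋁-cong λ { true → refl ; false → refl })

  ·-joinˡ : ∀ α β γ → (α · join ⋁ β γ) ≡ join ⋁ (α · β) (α · γ)
  ·-joinˡ α β γ = trans (·-⋁ˡ α _) (⋁-cong λ { true → refl ; false → refl })

  ·-mono : ∀ {α α' β β'} → α ≤ α' → β ≤ β' → (α · β) ≤ (α' · β')
  ·-mono {α' = α'} {β = β} α≤α' β≤β' =
    ≤-trans (join-preserving⇒monotone (_· β) (λ α α' → ·-joinʳ α α' β) α≤α')
            (join-preserving⇒monotone (α' ·_) (·-joinˡ α') β≤β')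

record IsIdempotentUnit {X : Set} (_⊙_ : MultiOp X) (ℓ r : X → X) (a : X) : Set where
  field
    ℓ-fixed      : ℓ a ≡ a
    r-fixed      : r a ≡ a
    self-product : (a ⊙ a) a

module LRMultimagmaProperties
  {X : Set} {_⊙_ : MultiOp X} {ℓ r : X → X}
  (isLRMultimagma : IsLRMultimagma X _⊙_ ℓ r) where

  open IsLRMultimagma isLRMultimagma

  ℓx⊙x∋x : ∀ x → (ℓ x ⊙ x) x
  ℓx⊙x∋x x = Equivalence.from (ℓ-unit x x) refl

  rℓ≡ℓ : ∀ x → r (ℓ x) ≡ ℓ x
  rℓ≡ℓ x = D⇒match (ℓ x) x (x , ℓx⊙x∋x x)

  ℓx⊙ℓx∋ℓx : ∀ x → (ℓ x ⊙ ℓ x) (ℓ x)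
  ℓx⊙ℓx∋ℓx x = subst (λ u → (ℓ x ⊙ u) (ℓ x)) (rℓ≡ℓ x)
                 (Equivalence.from (r-unit (ℓ x) (ℓ x)) refl)

  ℓℓ≡ℓ : ∀ x → ℓ (ℓ x) ≡ ℓ x
  ℓℓ≡ℓ x = trans (sym (D⇒match (ℓ x) (ℓ x) (ℓ x , ℓx⊙ℓx∋ℓx x))) (rℓ≡ℓ x)

  ℓ-isIdempotentUnit : ∀ x → IsIdempotentUnit _⊙_ ℓ r (ℓ x)
  ℓ-isIdempotentUnit x = record
    { ℓ-fixed = ℓℓ≡ℓ x ; r-fixed = rℓ≡ℓ x ; self-product = ℓx⊙ℓx∋ℓx x }

module EvaluationAtUnit
  {X : Set} (_⊙_ : MultiOp X) (ℓ r : X → X)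
  {a : X} (unit : IsIdempotentUnit _⊙_ ℓ r a)
  {Q : Set} {_≤_ : Rel Q 0ℓ} {⋁ : SupOp Q} {_·_ : Q → Q → Q} {e : Q}
  (isPrequantale : IsPrequantale _≡_ _≤_ ⋁ _·_ e) (dom cod : Q → Q) where

  open FunSpace _⊙_ ℓ r _≤_ ⋁ _·_ e dom cod
  open IsPrequantale isPrequantale using (⋁-upper; ⋁-least)
  open PrequantaleProperties isPrequantale
  open IsIdempotentUnit unit

  PeakAt : (X → Q) → Q → Set
  PeakAt f v = f a ≡ v × (∀ x → f x ≤ v)

  peak-≈ : ∀ {f g v w} → f ≈ᴾ g → PeakAt f v → PeakAt g w → v ≡ w
  peak-≈ f≈g (fa≡v , _) (ga≡w , _) = trans (sym fa≡v) (trans (f≈g a) ga≡w)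

  peak-≤ : ∀ {f g v w} → f ≤ᴾ g → PeakAt f v → PeakAt g w → v ≤ w
  peak-≤ f≤g (fa≡v , _) (ga≡w , _) =
    ≤-trans (≤-reflexive (sym fa≡v)) (≤-trans (f≤g a) (≤-reflexive ga≡w))

  const-peak : ∀ v → PeakAt (const v) v
  const-peak v = refl , λ _ → ≤-refl

  ∗-peak : ∀ {f g v w} → PeakAt f v → PeakAt g w → PeakAt (f ∗ g) (v · w)
  ∗-peak {f} {g} {v} {w} (fa≡v , f≤v) (ga≡w , g≤w) =
    ⋁-attained _ ((a , a) , self-product) (cong₂ _·_ fa≡v ga≡w) bounded ,
    λ _ → ⋁-least _ _ bounded
    where
    bounded : ∀ {x} (q : Σ (X × X) (λ p → (proj₁ p ⊙ proj₂ p) x)) →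
              (f (proj₁ (proj₁ q)) · g (proj₂ (proj₁ q))) ≤ (v · w)
    bounded _ = ·-mono (f≤v _) (g≤w _)

  ⋁ᴾ-peak : ∀ {I : Set} {F : I → X → Q} {v : I → Q} →
            (∀ i → PeakAt (F i) (v i)) → PeakAt (⋁ᴾ F) (⋁ v)
  ⋁ᴾ-peak peaks = ⋁-cong (λ i → proj₁ (peaks i)) ,
                  λ x → ⋁-mono (λ i → proj₂ (peaks i) x)

  join-peak : ∀ {f g v w} → PeakAt f v → PeakAt g w → PeakAt (join ⋁ᴾ f g) (join ⋁ v w)
  join-peak f-peak g-peak = ⋁ᴾ-peak λ { true → f-peak ; false → g-peak }

  bot-peak : PeakAt (bot ⋁ᴾ) (bot ⋁)
  bot-peak = ⋁ᴾ-peak λ ()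

  idE-peak : PeakAt idE e
  idE-peak = ⋁-attained _ ℓ-fixed refl (λ _ → ≤-refl) ,
             λ _ → ⋁-least _ e (λ _ → ≤-refl)

  -- Dom is the pushforward of dom along ℓ, and Cod that of cod along r.
  pushforward : (X → X) → (Q → Q) → (X → Q) → X → Q
  pushforward s d f y = ⋁ {Σ X (λ x → s x ≡ y)} (λ q → d (f (proj₁ q)))

  pushforward-peak : ∀ s d f {v} → s a ≡ a → f a ≡ v → (∀ x → d (f x) ≤ d v) →
                     PeakAt (pushforward s d f) (d v)
  pushforward-peak s d f sa≡a fa≡v df≤dv =
    ⋁-attained _ (a , sa≡a) (cong d fa≡v) (λ _ → df≤dv _) ,
    λ _ → ⋁-least _ _ (λ _ → df≤dv _)

  JoinPreserving : ((X → Q) → X → Q) → Set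
  JoinPreserving F = ∀ f g → F (join ⋁ᴾ f g) ≈ᴾ join ⋁ᴾ (F f) (F g)

  joinᴾ-const : ∀ α β x → join ⋁ᴾ (const α) (const β) x ≡ join ⋁ α β
  joinᴾ-const α β x = ⋁-cong λ { true → refl ; false → refl }

  -- Evaluated at constant functions, join preservation of the pushforward
  -- needs no monotonicity of d; monotonicity of d then follows from it.
  pushforward-join : ∀ s d → s a ≡ a → JoinPreserving (pushforward s d) →
                     ∀ α β → d (join ⋁ α β) ≡ join ⋁ (d α) (d β)
  pushforward-join s d sa≡a push-join α β =
    peak-≈ (push-join (const α) (const β)) join-push (join-peak (const-push α) (const-push β))
    where
    const-push : ∀ γ → PeakAt (pushforward s d (const γ)) (d γ)
    const-push γ = pushforward-peak s d (const γ) sa≡a refl (λ _ → ≤-refl)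

    join-push : PeakAt (pushforward s d (join ⋁ᴾ (const α) (const β))) (d (join ⋁ α β))
    join-push = pushforward-peak s d _ sa≡a (joinᴾ-const α β a)
                  (λ x → ≤-reflexive (cong d (joinᴾ-const α β x)))

  pushforward-monotone-peak : ∀ s d → s a ≡ a → JoinPreserving (pushforward s d) →
                              ∀ {f v} → PeakAt f v → PeakAt (pushforward s d f) (d v)
  pushforward-monotone-peak s d sa≡a push-join {f} (fa≡v , f≤v) =
    pushforward-peak s d f sa≡a fa≡v
      (λ x → join-preserving⇒monotone d (pushforward-join s d sa≡a push-join) (f≤v x))

module ModalTransfer
  {X : Set} (_⊙_ : MultiOp X) (ℓ r : X → X)
  {a : X} (unit : IsIdempotentUnit _⊙_ ℓ r a)
  {Q : Set} {_≤_ : Rel Q 0ℓ} {⋁ : SupOp Q} {_·_ : Q → Q → Q} {e : Q}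
  (isPrequantale : IsPrequantale _≡_ _≤_ ⋁ _·_ e) (dom cod : Q → Q) where

  open FunSpace _⊙_ ℓ r _≤_ ⋁ _·_ e dom cod
  open EvaluationAtUnit _⊙_ ℓ r unit isPrequantale dom cod
  open IsIdempotentUnit unit

  ·-assoc-transfer : (∀ f g h → ((f ∗ g) ∗ h) ≈ᴾ (f ∗ (g ∗ h))) →
                     ∀ α β γ → ((α · β) · γ) ≡ (α · (β · γ))
  ·-assoc-transfer ∗-assoc α β γ =
    peak-≈ (∗-assoc (const α) (const β) (const γ))
      (∗-peak (∗-peak (const-peak α) (const-peak β)) (const-peak γ))
      (∗-peak (const-peak α) (∗-peak (const-peak β) (const-peak γ)))

  module _ (modalBaseᴾ : ModalBase _≈ᴾ_ _≤ᴾ_ ⋁ᴾ _∗_ idE Dom Cod) where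
    open ModalBase modalBaseᴾ

    Dom-peak : ∀ {f v} → PeakAt f v → PeakAt (Dom f) (dom v)
    Dom-peak = pushforward-monotone-peak ℓ dom ℓ-fixed dom-join

    Cod-peak : ∀ {f v} → PeakAt f v → PeakAt (Cod f) (cod v)
    Cod-peak = pushforward-monotone-peak r cod r-fixed cod-join

    Dom-const-peak : ∀ α → PeakAt (Dom (const α)) (dom α)
    Dom-const-peak α = Dom-peak (const-peak α)

    Cod-const-peak : ∀ α → PeakAt (Cod (const α)) (cod α)
    Cod-const-peak α = Cod-peak (const-peak α)

    modalBase-transfer : ModalBase _≡_ _≤_ ⋁ _·_ e dom cod
    modalBase-transfer = record
      { dom-cong   = cong dom
      ; cod-cong   = cong cod
      ; dom-absorb = λ α → peak-≤ (dom-absorb (const α))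
                       (const-peak α) (∗-peak (Dom-const-peak α) (const-peak α))
      ; cod-absorb = λ α → peak-≤ (cod-absorb (const α))
                       (const-peak α) (∗-peak (const-peak α) (Cod-const-peak α))
      ; dom-sub    = λ α → peak-≤ (dom-sub (const α)) (Dom-const-peak α) idE-peak
      ; cod-sub    = λ α → peak-≤ (cod-sub (const α)) (Cod-const-peak α) idE-peak
      ; dom-strict = peak-≈ dom-strict (Dom-peak bot-peak) bot-peak
      ; cod-strict = peak-≈ cod-strict (Cod-peak bot-peak) bot-peak
      ; dom-join   = pushforward-join ℓ dom ℓ-fixed dom-join
      ; cod-join   = pushforward-join r cod r-fixed cod-join
      ; dom-cod    = λ α → peak-≈ (dom-cod (const α))
                       (Dom-peak (Cod-const-peak α)) (Cod-const-peak α)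
      ; cod-dom    = λ α → peak-≈ (cod-dom (const α))
                       (Cod-peak (Dom-const-peak α)) (Dom-const-peak α)
      }

    dom-export-transfer : (∀ f g → Dom (Dom f ∗ g) ≈ᴾ (Dom f ∗ Dom g)) →
                          ∀ α β → dom (dom α · β) ≡ (dom α · dom β)
    dom-export-transfer Dom-export α β = peak-≈ (Dom-export (const α) (const β))
      (Dom-peak (∗-peak (Dom-const-peak α) (const-peak β)))
      (∗-peak (Dom-const-peak α) (Dom-const-peak β))

    cod-export-transfer : (∀ f g → Cod (f ∗ Cod g) ≈ᴾ (Cod f ∗ Cod g)) →
                          ∀ α β → cod (α · cod β) ≡ (cod α · cod β)
    cod-export-transfer Cod-export α β = peak-≈ (Cod-export (const α) (const β))
      (Cod-peak (∗-peak (const-peak α) (Cod-const-peak β)))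
      (∗-peak (Cod-const-peak α) (Cod-const-peak β))

    dom-local-transfer : (∀ f g → Dom (f ∗ Dom g) ≈ᴾ Dom (f ∗ g)) →
                         ∀ α β → dom (α · dom β) ≡ dom (α · β)
    dom-local-transfer Dom-local α β = peak-≈ (Dom-local (const α) (const β))
      (Dom-peak (∗-peak (const-peak α) (Dom-const-peak β)))
      (Dom-peak (∗-peak (const-peak α) (const-peak β)))

    cod-local-transfer : (∀ f g → Cod (Cod f ∗ g) ≈ᴾ Cod (f ∗ g)) →
                         ∀ α β → cod (cod α · β) ≡ cod (α · β)
    cod-local-transfer Cod-local α β = peak-≈ (Cod-local (const α) (const β))
      (Cod-peak (∗-peak (Cod-const-peak α) (const-peak β)))
      (Cod-peak (∗-peak (const-peak α) (const-peak β)))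

  isModalPrequantale-transfer : IsModalPrequantale _≈ᴾ_ _≤ᴾ_ ⋁ᴾ _∗_ idE Dom Cod →
                                IsModalPrequantale _≡_ _≤_ ⋁ _·_ e dom cod
  isModalPrequantale-transfer M = record
    { isPrequantale = isPrequantale
    ; modalBase     = modalBase-transfer modalBase
    ; dom-export    = dom-export-transfer modalBase dom-export
    ; cod-export    = cod-export-transfer modalBase cod-export
    }
    where open IsModalPrequantale M using (modalBase; dom-export; cod-export)

  isWeaklyLocalModalQuantale-transfer :
    IsWeaklyLocalModalQuantale _≈ᴾ_ _≤ᴾ_ ⋁ᴾ _∗_ idE Dom Cod →
    IsWeaklyLocalModalQuantale _≡_ _≤_ ⋁ _·_ e dom cod
  isWeaklyLocalModalQuantale-transfer W = record
    { isModalPrequantale = isModalPrequantale-transfer isModalPrequantale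
    ; ·-assoc            = ·-assoc-transfer ·-assoc
    }
    where open IsWeaklyLocalModalQuantale W using (isModalPrequantale; ·-assoc)

  isModalQuantale-transfer : IsModalQuantale _≈ᴾ_ _≤ᴾ_ ⋁ᴾ _∗_ idE Dom Cod →
                             IsModalQuantale _≡_ _≤_ ⋁ _·_ e dom cod
  isModalQuantale-transfer M = record
    { isPrequantale = isPrequantale
    ; ·-assoc       = ·-assoc-transfer ·-assoc
    ; modalBase     = modalBase-transfer modalBase
    ; dom-local     = dom-local-transfer modalBase dom-local
    ; cod-local     = cod-local-transfer modalBase cod-local
    }
    where open IsModalQuantale M using (·-assoc; modalBase; dom-local; cod-local)

theorem8p5 : (X : Set) (_⊙_ : MultiOp X) (ℓ r : X → X) →
    IsLRMultimagma X _⊙_ ℓ r →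
    (∃ λ x → ∃ λ y → D _⊙_ (ℓ x) (ℓ y)) →
    (∃ λ z → ∃ λ w → D _⊙_ z w) →
    (Q : Set) (_≤_ : Rel Q 0ℓ) (⋁ : SupOp Q) (_·_ : Q → Q → Q) (e : Q) →
    IsPrequantale _≡_ _≤_ ⋁ _·_ e →
    (dom cod : Q → Q) →
    let open FunSpace _⊙_ ℓ r _≤_ ⋁ _·_ e dom cod in
    IsModalPrequantale _≈ᴾ_ _≤ᴾ_ ⋁ᴾ _∗_ idE Dom Cod →
    ¬ (idE ≈ᴾ bot ⋁ᴾ) →
    IsModalPrequantale _≡_ _≤_ ⋁ _·_ e dom cod
    × (IsLRMultisemigroup X _⊙_ ℓ r →
       IsWeaklyLocalModalQuantale _≈ᴾ_ _≤ᴾ_ ⋁ᴾ _∗_ idE Dom Cod →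
       IsWeaklyLocalModalQuantale _≡_ _≤_ ⋁ _·_ e dom cod)
    × (IsLocalLRMultisemigroup X _⊙_ ℓ r →
       IsModalQuantale _≈ᴾ_ _≤ᴾ_ ⋁ᴾ _∗_ idE Dom Cod →
       IsModalQuantale _≡_ _≤_ ⋁ _·_ e dom cod)
theorem8p5 X _⊙_ ℓ r lr (x , _) _ Q _≤_ ⋁ _·_ e isPrequantale dom cod M _ =
  isModalPrequantale-transfer M ,
  (λ _ → isWeaklyLocalModalQuantale-transfer) ,
  (λ _ → isModalQuantale-transfer)
  where
  open LRMultimagmaProperties lr using (ℓ-isIdempotentUnit)
  open ModalTransfer _⊙_ ℓ r (ℓ-isIdempotentUnit x) isPrequantale dom cod
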